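{- Let $r\ge1$, $b\in\mathcal{T}(\infty)$, and let $\psi(b)=(a_{1,1};a_{2,1},a_{2,2};\dots;a_{r,1},\dots,a_{r,r})$ be its string parametrization as described in the context. Let $2\le k\le r+1$. Then the tableau \[ \widetilde e_1^{a_{k-1,k-1}}\widetilde e_2^{a_{k-1,k-2}} \cdots \widetilde e_{k-1}^{a_{k-1,1}} \cdots \widetilde e_1^{a_{2,2}} \widetilde e_2^{a_{2,1}} \widetilde e_1^{a_{1,1}}\, b \] contains no $j$-segments for any $2\le j\le k$.
   Context: Tableaux are in English convention. $\mathcal{T}(\infty)$ is the set of tableaux $b$ with entries in $\{1,\dots,r+1\}$, semistandard (rows weakly increasing, columns strictly increasing), with exactly $r$ rows, whose leftmost column has entry $j$ in row $j$ for $1\le j\le r$, and which are marginally large: for each $1\le i\le r$ the number of entries $i$ in row $i$ exceeds the number of boxes in row $i+1$ by exactly one. For $2\le k\le r+1$, a $k$-segment is a maximal run of boxes with entry $k$ in a row $j$ with $j\le k-1$ (entries $k$ in row $k$ do not form segments). Kashiwara operators $\widetilde e_i$ ($1\le i\le r$) on $\mathcal{T}(\infty)\sqcup\{0\}$: read the entries column by column from right to left, each column top to bottom; record $+$ for each entry $i$, $-$ for each entry $i+1$; repeatedly cancel pairs $+$ followed by $-$ until $-\cdots-+\cdots+$ remains. If no $-$ remains, $\widetilde e_ib=0$; otherwise change the entry of the rightmost remaining $-$ from $i+1$ to $i$, and if the result is not marginally large (exactly when the changed box was immediately right of the rightmost $i$ in row $i$) remove the column containing the changed box (a column with entries $1,\dots,i$).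 String parametrization for the word $(1;2,1;3,2,1;\dots;r,r-1,\dots,1)$: set $b_0=b$ and successively, for $j=1,\dots,r$ and $\ell=1,\dots,j$, let $a_{j,\ell}$ be the maximal integer such that $\widetilde e_{j+1-\ell}^{a_{j,\ell}}$ applied to the current tableau is nonzero, and replace the current tableau by that result (the order of operators is $\widetilde e_1;\widetilde e_2,\widetilde e_1;\widetilde e_3,\widetilde e_2,\widetilde e_1;\dots$). -}

module Defs where

open import Data.Nat using (ℕ; zero; suc; _+_; _∸_; _≤_; _<_; _⊔_; _≡ᵇ_)
open import Data.Bool using (Bool; true; false; if_then_else_; _∧_)
open import Data.List using (List; []; _∷_; length; map; concatMap; downFrom; upTo)
open import Data.Maybe using (Maybe; just; nothing; maybe; _>>=_)
open import Data.Product using (Σ; _×_; _,_)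
open import Data.List.Membership.Propositional using (_∈_)
open import Relation.Binary.PropositionalEquality using (_≡_)
open import Relation.Nullary using (¬_)

-- Tableaux: a list of rows (top row first), each row a list of entries
-- (left to right).  Rows/columns are indexed from 0 internally; the
-- mathematical row j (1-based) is the list element with index j ∸ 1.

Tableau : Set
Tableau = List (List ℕ)

nth : {A : Set} → ℕ → List A → Maybe A
nth _       []       = nothing
nth zero    (x ∷ _)  = just x
nth (suc n) (_ ∷ xs) = nth n xs

modifyAt : {A : Set} → ℕ → (A → A) → List A → List A
modifyAt _       f []       = []
modifyAt zero    f (x ∷ xs) = f x ∷ xs
modifyAt (suc n) f (x ∷ xs) = x ∷ modifyAt n f xs

removeAt : {A : Set} → ℕ → List A → List A
removeAt _       []       = []
removeAt zero    (_ ∷ xs) = xs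
removeAt (suc n) (x ∷ xs) = x ∷ removeAt n xs

count : ℕ → List ℕ → ℕ
count n []       = 0
count n (x ∷ xs) = if x ≡ᵇ n then suc (count n xs) else count n xs

rowLen : ℕ → Tableau → ℕ
rowLen i b = maybe length 0 (nth i b)

record IsTInf (r : ℕ) (b : Tableau) : Set where
  field
    rows      : length b ≡ r
    entries   : ∀ j row x → nth j b ≡ just row → x ∈ row → 1 ≤ x × x ≤ suc r
    rowWeak   : ∀ j row c x y → nth j b ≡ just row →
                nth c row ≡ just x → nth (suc c) row ≡ just y → x ≤ y
    shape     : ∀ j row row' → nth j b ≡ just row → nth (suc j) b ≡ just row' →
                length row' ≤ length row
    colStrict : ∀ j row row' c x y → nth j b ≡ just row → nth (suc j) b ≡ just row' →
                nth c row ≡ just x → nth c row' ≡ just y → x < y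
    leftCol   : ∀ j row → nth j b ≡ just row → nth 0 row ≡ just (suc j)
    margLarge : ∀ j row → nth j b ≡ just row → count (suc j) row ≡ suc (rowLen (suc j) b)

mlRows : ℕ → Tableau → Bool
mlRows j []           = true
mlRows j (row ∷ rest) = (count (suc j) row ≡ᵇ suc (rowLen 0 rest)) ∧ mlRows (suc j) rest

isML : Tableau → Bool
isML = mlRows 0

-- Reading: columns from right to left, each column top to bottom.
-- Each box is recorded as (row index , column index , entry).

maxLen : Tableau → ℕ
maxLen []           = 0
maxLen (row ∷ rest) = length row ⊔ maxLen rest

columnRead : ℕ → ℕ → Tableau → List (ℕ × ℕ × ℕ)
columnRead c j []           = []
columnRead c j (row ∷ rest) with nth c row
... | just x  = (j , c , x) ∷ columnRead c (suc j) rest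
... | nothing = columnRead c (suc j) rest

reading : Tableau → List (ℕ × ℕ × ℕ)
reading b = concatMap (λ c → columnRead c 0 b) (downFrom (maxLen b))

-- Signature rule for ẽ_i: entries i give +, entries i+1 give −;
-- cancel (+,−) pairs; return position of the rightmost uncancelled −.
-- 'nOpen' counts the currently uncancelled +'s.
rightmostMinus : ℕ → List (ℕ × ℕ × ℕ) → ℕ → Maybe (ℕ × ℕ) → Maybe (ℕ × ℕ)
rightmostMinus i []                  nOpen acc = acc
rightmostMinus i ((j , c , x) ∷ xs) nOpen acc =
  if x ≡ᵇ i then rightmostMinus i xs (suc nOpen) acc
  else if x ≡ᵇ suc i then step nOpen
  else rightmostMinus i xs nOpen acc
  where
  step : ℕ → Maybe (ℕ × ℕ)
  step zero     = rightmostMinus i xs zero (just (j , c))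
  step (suc o)  = rightmostMinus i xs o acc

removeCol : ℕ → Tableau → Tableau
removeCol c = map (removeAt c)

-- Kashiwara operator ẽ_i ; 'nothing' stands for 0.
e~ : ℕ → Tableau → Maybe Tableau
e~ i b with rightmostMinus i (reading b) 0 nothing
... | nothing      = nothing
... | just (j , c) =
  let b' = modifyAt j (modifyAt c (λ _ → i)) b in
  if isML b' then just b' else just (removeCol c b')

e~pow : ℕ → ℕ → Tableau → Maybe Tableau
e~pow i zero    b = just b
e~pow i (suc a) b = e~ i b >>= e~pow i a

-- String parametrization for the word (1;2,1;3,2,1;…).
-- steps m = [(1,1);(2,1),(2,2);…;(m,1),…,(m,m)]; step (j,ℓ) uses ẽ_{j+1-ℓ}.

steps : ℕ → List (ℕ × ℕ)
steps m = concatMap (λ j → map (λ ℓ → (suc j , suc ℓ)) (upTo (suc j))) (upTo m)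

opIndex : ℕ × ℕ → ℕ
opIndex (j , ℓ) = suc j ∸ ℓ

applySteps : (ℕ → ℕ → ℕ) → List (ℕ × ℕ) → Tableau → Maybe Tableau
applySteps a []              b = just b
applySteps a ((j , ℓ) ∷ ps) b = e~pow (opIndex (j , ℓ)) (a j ℓ) b >>= applySteps a ps

IsString : (ℕ → ℕ → ℕ) → List (ℕ × ℕ) → Tableau → Set
IsString a []              b = Data.Unit.⊤ where import Data.Unit
IsString a ((j , ℓ) ∷ ps) b =
  Σ Tableau λ c → e~pow (opIndex (j , ℓ)) (a j ℓ) b ≡ just c
                × e~pow (opIndex (j , ℓ)) (suc (a j ℓ)) b ≡ nothing
                × IsString a ps c

-- ψ(b) = a (on the indices 1 ≤ ℓ ≤ j ≤ r)
IsStringParam : ℕ → Tableau → (ℕ → ℕ → ℕ) → Set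
IsStringParam r b a = IsString a (steps r) b

-- Segments.  A k-segment lies in row m (1-based) with m ≤ k-1 and consists
-- of entries k; b has a k-segment iff some row m ≤ k-1 contains an entry k.

HasSegment : ℕ → Tableau → Set
HasSegment k b = Σ ℕ λ m → Σ (List ℕ) λ row →
  1 ≤ m × m ≤ k ∸ 1 × nth (m ∸ 1) b ≡ just row × k ∈ row

NoSegmentsUpTo : ℕ → Tableau → Set
NoSegmentsUpTo k b = ∀ j → 2 ≤ j → j ≤ k → ¬ HasSegment j b

-- The string parametrization works in phases: phase m applies ẽ_m, …, ẽ_1 maximally. Before phase m
-- there are no ℓ-segments with ℓ ≤ m, so among the ℓ-segments with ℓ ≤ m+1 only (m+1)-segments occur,
-- in rows 1,…,m. Suppose the only small segments are i- and (i+1)-segments in rows ≤ i, with the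
-- i-segments left of the (i+1)-segments. Then the signature rule for ẽ_i selects the leftmost box of an
-- (i+1)-segment: every other entry i+1 lies below an i, and the i-segments are read last. Lowering that
-- box to i keeps the tableau semistandard and the segments ordered; it stays marginally large unless the
-- box is in row i, where the column it ends becomes 1,…,i and is removed. So once ẽ_i stops applying,
-- all (i+1)-segments have become i-segments and ẽ_{i-1} takes over; after ẽ_1 no ℓ-segments with
-- ℓ ≤ m+1 are left.

module Submission where

open import Defs
open import Data.Bool using (Bool; true; false; if_then_else_)
open import Data.Empty using (⊥-elim)
open import Data.List using (List; []; _∷_; [_]; length; map; concatMap; upTo; downFrom; _++_; applyUpTo)
open import Data.List.Properties using (map-upTo; concatMap-++; ++-assoc; ++-identityʳ; applyUpTo-∷ʳ)
open import Data.List.Membership.Propositional using (_∈_)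
open import Data.List.Relation.Unary.Any using (here; there)
open import Data.Maybe using (Maybe; just; nothing; maybe; _>>=_)
import Data.Maybe as Maybe
open import Data.Maybe.Properties using (just-injective)
open import Data.Nat using (ℕ; zero; suc; _+_; _∸_; _≤_; _<_; _≤′_; ≤′-refl; ≤′-step; _≡ᵇ_; z≤n; s≤s; _≟_; _<?_)
open import Data.Nat.Properties
open import Data.Product using (Σ; ∃-syntax; _×_; _,_; proj₁; proj₂)
open import Data.Sum using (_⊎_; inj₁; inj₂)
open import Function using (_∘_)
open import Relation.Binary.Definitions using (tri<; tri≈; tri>)
open import Relation.Binary.PropositionalEquality hiding ([_])
open import Relation.Nullary using (¬_; yes; no)
open import Relation.Nullary.Reflects using (Reflects; ofʸ; ofⁿ; fromEquivalence)

≡ᵇ-reflects : ∀ m n → Reflects (m ≡ n) (m ≡ᵇ n)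
≡ᵇ-reflects m n = fromEquivalence (≡ᵇ⇒≡ m n) (≡⇒≡ᵇ m n)

≡ᵇ-refl : ∀ n → (n ≡ᵇ n) ≡ true
≡ᵇ-refl zero    = refl
≡ᵇ-refl (suc n) = ≡ᵇ-refl n

≢⇒≡ᵇ-false : ∀ {m n} → m ≢ n → (m ≡ᵇ n) ≡ false
≢⇒≡ᵇ-false {m} {n} m≢n with m ≡ᵇ n | ≡ᵇ-reflects m n
... | true  | ofʸ m≡n = ⊥-elim (m≢n m≡n)
... | false | _       = refl

≡nothing⇒≢just : ∀ {A : Set} {m : Maybe A} {y} → m ≡ nothing → m ≢ just y
≡nothing⇒≢just refl ()

≡just⇒≢just : ∀ {A : Set} {m : Maybe A} {x y} → m ≡ just x → x ≢ y → m ≢ just y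
≡just⇒≢just refl x≢y = x≢y ∘ just-injective

Defined : Maybe ℕ → Set
Defined m = ∃[ x ] m ≡ just x

nth⇒< : ∀ (row : List ℕ) c {x} → nth c row ≡ just x → c < length row
nth⇒< (_ ∷ row) zero    _ = s≤s z≤n
nth⇒< (_ ∷ row) (suc c) e = s≤s (nth⇒< row c e)

<⇒nth : ∀ (row : List ℕ) c → c < length row → Defined (nth c row)
<⇒nth (y ∷ row) zero    _         = y , refl
<⇒nth (_ ∷ row) (suc c) (s≤s c<n) = <⇒nth row c c<n

∈⇒nth : ∀ {x} (row : List ℕ) → x ∈ row → ∃[ c ] nth c row ≡ just x
∈⇒nth (_ ∷ row) (here refl) = zero , refl
∈⇒nth (_ ∷ row) (there x∈) with ∈⇒nth row x∈
... | c , e = suc c , e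

nth-map : ∀ {A B : Set} (f : A → B) j xs → nth j (map f xs) ≡ Maybe.map f (nth j xs)
nth-map f j       []       = refl
nth-map f zero    (x ∷ xs) = refl
nth-map f (suc j) (x ∷ xs) = nth-map f j xs

nth-pred : ∀ (b : Tableau) j {row} → nth (suc j) b ≡ just row → ∃[ row' ] nth j b ≡ just row'
nth-pred (row ∷ b) zero    _ = row , refl
nth-pred (_ ∷ b)   (suc j) e = nth-pred b j e

entry : Tableau → ℕ → ℕ → Maybe ℕ
entry []        _       _ = nothing
entry (row ∷ _) zero    c = nth c row
entry (_ ∷ b)   (suc j) c = entry b j c

entry-nth : ∀ b j {row} c → nth j b ≡ just row → entry b j c ≡ nth c row
entry-nth (_ ∷ b) zero    c refl = refl
entry-nth (_ ∷ b) (suc j) c e    = entry-nth b j c e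

entry⇒nth : ∀ b j c {x} → entry b j c ≡ just x → ∃[ row ] nth j b ≡ just row × nth c row ≡ just x
entry⇒nth (row ∷ b) zero    c e = row , refl , e
entry⇒nth (_ ∷ b)   (suc j) c e = entry⇒nth b j c e

entry-left : ∀ b j {c c' x} → c' ≤ c → entry b j c ≡ just x → Defined (entry b j c')
entry-left (row ∷ b) zero    {c} {c'} c'≤c e = <⇒nth row c' (≤-<-trans c'≤c (nth⇒< row c e))
entry-left (_ ∷ b)   (suc j)          c'≤c e = entry-left b j c'≤c e

entry⇒<maxLen : ∀ b j c {x} → entry b j c ≡ just x → c < maxLen b
entry⇒<maxLen (row ∷ b) zero    c e = ≤-trans (nth⇒< row c e) (m≤m⊔n (length row) (maxLen b))
entry⇒<maxLen (row ∷ b) (suc j) c e = ≤-trans (entry⇒<maxLen b j c e) (m≤n⊔m (length row) (maxLen b))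

columnHas? : ∀ b c v → (∃[ t ] entry b t c ≡ just v) ⊎ (∀ t → entry b t c ≢ just v)
columnHas? []          c v = inj₂ λ _ ()
columnHas? (row ∷ b) c v with nth c row in e | columnHas? b c v
... | just x  | _ with x ≟ v
...   | yes refl = inj₁ (0 , e)
columnHas? (row ∷ b) c v | just x | inj₁ (t , e') | no _ = inj₁ (suc t , e')
columnHas? (row ∷ b) c v | just x | inj₂ none | no x≢v =
  inj₂ λ { zero → ≡just⇒≢just e x≢v ; (suc t) → none t }
columnHas? (row ∷ b) c v | nothing | inj₁ (t , e') = inj₁ (suc t , e')
columnHas? (row ∷ b) c v | nothing | inj₂ none =
  inj₂ λ { zero → ≡nothing⇒≢just e ; (suc t) → none t }

-- The signature rule

-- rightmostMinus, also returning the number of uncancelled +'s, so that a reading can be scanned piecewise.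
scan : ℕ → List (ℕ × ℕ × ℕ) → ℕ → Maybe (ℕ × ℕ) → ℕ × Maybe (ℕ × ℕ)
scan i []                  p acc = p , acc
scan i ((j , c , x) ∷ xs) p acc =
  if x ≡ᵇ i then scan i xs (suc p) acc
  else if x ≡ᵇ suc i then minus p
  else scan i xs p acc
  where
  minus : ℕ → ℕ × Maybe (ℕ × ℕ)
  minus zero    = scan i xs zero (just (j , c))
  minus (suc p) = scan i xs p acc

rightmostMinus≡scan : ∀ i xs p acc → rightmostMinus i xs p acc ≡ proj₂ (scan i xs p acc)
rightmostMinus≡scan i [] p acc = refl
rightmostMinus≡scan i ((j , c , x) ∷ xs) p acc with x ≡ᵇ i | x ≡ᵇ suc i | p
... | true  | _     | q     = rightmostMinus≡scan i xs (suc q) acc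
... | false | false | q     = rightmostMinus≡scan i xs q acc
... | false | true  | zero  = rightmostMinus≡scan i xs zero (just (j , c))
... | false | true  | suc q = rightmostMinus≡scan i xs q acc

scan-++ : ∀ i xs ys p acc →
  scan i (xs ++ ys) p acc ≡ scan i ys (proj₁ (scan i xs p acc)) (proj₂ (scan i xs p acc))
scan-++ i [] ys p acc = refl
scan-++ i ((j , c , x) ∷ xs) ys p acc with x ≡ᵇ i | x ≡ᵇ suc i | p
... | true  | _     | q     = scan-++ i xs ys (suc q) acc
... | false | false | q     = scan-++ i xs ys q acc
... | false | true  | zero  = scan-++ i xs ys zero (just (j , c))
... | false | true  | suc q = scan-++ i xs ys q acc

-- Every entry i+1 in column c is cancelled by an i: by one of the p pending +'s if it is the top box,
-- and otherwise by the entry right above it.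
ColumnCancels : ℕ → Tableau → ℕ → ℕ → Set
ColumnCancels i b c p = ∀ t → entry b t c ≡ just (suc i) →
  (t ≡ 0 × 1 ≤ p) ⊎ ∃[ t' ] t ≡ suc t' × entry b t' c ≡ just i

ColumnCancels-tail : ∀ {i row b c p} q → ColumnCancels i (row ∷ b) c p → nth c row ≢ just i →
  ColumnCancels i b c q
ColumnCancels-tail q cancels ¬i t e with cancels (suc t) e
... | inj₂ (zero ,   refl , e') = ⊥-elim (¬i e')
... | inj₂ (suc t' , refl , e') = inj₂ (t' , refl , e')

ColumnCancels-tail-plus : ∀ {i row b c p} → ColumnCancels i (row ∷ b) c p → nth c row ≡ just i →
  ColumnCancels i b c (suc p)
ColumnCancels-tail-plus cancels _ t e with cancels (suc t) e
... | inj₂ (zero ,   refl , _)  = inj₁ (refl , s≤s z≤n)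
... | inj₂ (suc t' , refl , e') = inj₂ (t' , refl , e')

scan-cancellingColumn : ∀ i c b j p acc → ColumnCancels i b c p →
  proj₂ (scan i (columnRead c j b) p acc) ≡ acc
scan-cancellingColumn i c []        j p acc cancels = refl
scan-cancellingColumn i c (row ∷ b) j p acc cancels with nth c row in e
... | nothing = scan-cancellingColumn i c b (suc j) p acc (ColumnCancels-tail p cancels (≡nothing⇒≢just e))
... | just x with x ≡ᵇ i | ≡ᵇ-reflects x i
...   | true  | ofʸ refl = scan-cancellingColumn i c b (suc j) (suc p) acc (ColumnCancels-tail-plus cancels e)
...   | false | ofⁿ x≢i with x ≡ᵇ suc i | ≡ᵇ-reflects x (suc i)
...     | false | _        =
  scan-cancellingColumn i c b (suc j) p acc (ColumnCancels-tail p cancels (≡just⇒≢just e x≢i))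
...     | true  | ofʸ refl with p | cancels 0 e
...       | _     | inj₂ (_ , () , _)
...       | zero  | inj₁ (_ , ())
...       | suc q | inj₁ _ =
  scan-cancellingColumn i c b (suc j) q acc (ColumnCancels-tail q cancels (≡just⇒≢just e x≢i))

-- The outcome of scanning column c of b, whose top box is in row j, starting from the accumulator acc.
ColumnMinus : ℕ → ℕ → Tableau → ℕ → Maybe (ℕ × ℕ) → Maybe (ℕ × ℕ) → Set
ColumnMinus i c b j acc acc' =
  (acc' ≡ acc × ∀ t → entry b t c ≢ just (suc i)) ⊎ ∃[ t ] acc' ≡ just (j + t , c) × entry b t c ≡ just (suc i)

ColumnMinus-∷ : ∀ {i c row b j acc acc'} → nth c row ≢ just (suc i) →
  ColumnMinus i c b (suc j) acc acc' → ColumnMinus i c (row ∷ b) j acc acc'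
ColumnMinus-∷ ¬i+1 (inj₁ (refl , none)) = inj₁ (refl , λ { zero → ¬i+1 ; (suc t) → none t })
ColumnMinus-∷ {c = c} {j = j} _ (inj₂ (t , refl , e)) = inj₂ (suc t , cong (λ z → just (z , c)) (sym (+-suc j t)) , e)

ColumnMinus-∷-minus : ∀ {i c row b j acc acc'} → nth c row ≡ just (suc i) →
  ColumnMinus i c b (suc j) (just (j , c)) acc' → ColumnMinus i c (row ∷ b) j acc acc'
ColumnMinus-∷-minus {c = c} {j = j} e (inj₁ (refl , _)) = inj₂ (0 , cong (λ z → just (z , c)) (sym (+-identityʳ j)) , e)
ColumnMinus-∷-minus {c = c} {j = j} _ (inj₂ (t , refl , e)) = inj₂ (suc t , cong (λ z → just (z , c)) (sym (+-suc j t)) , e)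

scan-plusFreeColumn : ∀ i c b j acc → (∀ t → entry b t c ≢ just i) →
  ∃[ acc' ] scan i (columnRead c j b) 0 acc ≡ (0 , acc') × ColumnMinus i c b j acc acc'
scan-plusFreeColumn i c []        j acc _ = acc , refl , inj₁ (refl , λ _ ())
scan-plusFreeColumn i c (row ∷ b) j acc noPlus with nth c row in e
... | nothing with scan-plusFreeColumn i c b (suc j) acc (λ t → noPlus (suc t))
...   | acc' , eq , m = acc' , eq , ColumnMinus-∷ (≡nothing⇒≢just e) m
scan-plusFreeColumn i c (row ∷ b) j acc noPlus | just x with x ≡ᵇ i | ≡ᵇ-reflects x i
... | true  | ofʸ refl = ⊥-elim (noPlus 0 e)
... | false | _ with x ≡ᵇ suc i | ≡ᵇ-reflects x (suc i)
...   | true  | ofʸ refl with scan-plusFreeColumn i c b (suc j) (just (j , c)) (λ t → noPlus (suc t))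
...     | acc' , eq , m = acc' , eq , ColumnMinus-∷-minus e m
scan-plusFreeColumn i c (row ∷ b) j acc noPlus | just x | false | _ | false | ofⁿ x≢i+1
  with scan-plusFreeColumn i c b (suc j) acc (λ t → noPlus (suc t))
... | acc' , eq , m = acc' , eq , ColumnMinus-∷ (≡just⇒≢just e x≢i+1) m

-- Well-formed tableaux

MarginallyLarge : Tableau → Set
MarginallyLarge b = ∀ j row → nth j b ≡ just row → count (suc j) row ≡ suc (rowLen (suc j) b)

record WellFormed (b : Tableau) : Set where
  field
    rowBound  : ∀ j c x → entry b j c ≡ just x → suc j ≤ x
    rowWeak   : ∀ j c c' x y → c ≤ c' → entry b j c ≡ just x → entry b j c' ≡ just y → x ≤ y
    colStrict : ∀ j j' c x y → j < j' → entry b j c ≡ just x → entry b j' c ≡ just y → x < y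
    shape     : ∀ j j' c y → j ≤ j' → entry b j' c ≡ just y → Defined (entry b j c)
    margLarge : MarginallyLarge b

module FromTInf {r : ℕ} {b : Tableau} (T : IsTInf r b) where
  open IsTInf T

  rowWeak-adjacent : ∀ j c x y → entry b j c ≡ just x → entry b j (suc c) ≡ just y → x ≤ y
  rowWeak-adjacent j c x y ex ey with entry⇒nth b j c ex
  ... | row , e-row , e-c = rowWeak j row c x y e-row e-c (trans (sym (entry-nth b j (suc c) e-row)) ey)

  shape-adjacent : ∀ j c y → entry b (suc j) c ≡ just y → Defined (entry b j c)
  shape-adjacent j c y ey with entry⇒nth b (suc j) c ey
  ... | row' , e-row' , e-c with nth-pred b j e-row'
  ...   | row , e-row with <⇒nth row c (≤-trans (nth⇒< row' c e-c) (shape j row row' e-row e-row'))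
  ...     | z , ez = z , trans (entry-nth b j c e-row) ez

  colStrict-adjacent : ∀ j c x y → entry b j c ≡ just x → entry b (suc j) c ≡ just y → x < y
  colStrict-adjacent j c x y ex ey with entry⇒nth b j c ex | entry⇒nth b (suc j) c ey
  ... | row , e-row , e-c | row' , e-row' , e-c' = colStrict j row row' c x y e-row e-row' e-c e-c'

  rowWeak′ : ∀ j c c' x y → c ≤ c' → entry b j c ≡ just x → entry b j c' ≡ just y → x ≤ y
  rowWeak′ j c c' x y c≤c' ex ey with m≤n⇒m<n∨m≡n c≤c'
  ... | inj₂ refl = ≤-reflexive (just-injective (trans (sym ex) ey))
  rowWeak′ j c (suc c') x y _ ex ey | inj₁ (s≤s c≤c') with entry-left b j (n≤1+n c') ey
  ... | z , ez = ≤-trans (rowWeak′ j c c' x z c≤c' ex ez) (rowWeak-adjacent j c' z y ez ey)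

  shape′ : ∀ j j' c y → j ≤ j' → entry b j' c ≡ just y → Defined (entry b j c)
  shape′ j j' c y j≤j' ey with m≤n⇒m<n∨m≡n j≤j'
  ... | inj₂ refl = y , ey
  shape′ j (suc j') c y _ ey | inj₁ (s≤s j≤j') with shape-adjacent j' c y ey
  ... | z , ez = shape′ j j' c z j≤j' ez

  colStrict′ : ∀ j j' c x y → j < j' → entry b j c ≡ just x → entry b j' c ≡ just y → x < y
  colStrict′ j (suc j') c x y (s≤s j≤j') ex ey with m≤n⇒m<n∨m≡n j≤j'
  ... | inj₂ refl = colStrict-adjacent j c x y ex ey
  ... | inj₁ j<j' with shape-adjacent j' c y ey
  ...   | z , ez = <-trans (colStrict′ j j' c x z j<j' ex ez) (colStrict-adjacent j' c z y ez ey)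

  wellFormed : WellFormed b
  WellFormed.rowBound wellFormed j c x e with entry⇒nth b j c e
  ... | row , e-row , _ = rowWeak′ j 0 c (suc j) x z≤n (trans (entry-nth b j 0 e-row) (leftCol j row e-row)) e
  WellFormed.rowWeak wellFormed   = rowWeak′
  WellFormed.colStrict wellFormed = colStrict′
  WellFormed.shape wellFormed     = shape′
  WellFormed.margLarge wellFormed = margLarge

SegmentBox : Tableau → ℕ → ℕ → ℕ → Set
SegmentBox b k t c = suc t < k × entry b t c ≡ just k

SegmentsOrdered : Tableau → ℕ → Set
SegmentsOrdered b i = ∀ t c t' c' → SegmentBox b i t c → SegmentBox b (suc i) t' c' → c < c'

columns : Tableau → ℕ → List (ℕ × ℕ × ℕ)
columns b M = concatMap (λ c → columnRead c 0 b) (downFrom M)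

module Signature (b : Tableau) (w : WellFormed b) (h : ℕ) (ordered : SegmentsOrdered b (suc h)) where
  open WellFormed w
  i = suc h

  diagonalAbove : ∀ c → entry b (suc h) c ≡ just (suc i) → entry b h c ≡ just i
  diagonalAbove c e with shape h (suc h) c (suc i) (n≤1+n h) e
  ... | y , ey = trans ey (cong just (≤-antisym (≤-pred (colStrict h (suc h) c y (suc i) ≤-refl ey e)) (rowBound h c y ey)))

  segmentFree⇒ColumnCancels : ∀ c p → (∀ t → ¬ SegmentBox b (suc i) t c) → ColumnCancels i b c p
  segmentFree⇒ColumnCancels c p none t e with m≤n⇒m<n∨m≡n (≤-pred (rowBound t c (suc i) e))
  ... | inj₁ t<i = ⊥-elim (none t (s≤s t<i , e))
  ... | inj₂ refl = inj₂ (h , refl , diagonalAbove c e)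

  plusFree⇒SegmentBox : ∀ c → (∀ t → entry b t c ≢ just i) → ∀ t → entry b t c ≡ just (suc i) → SegmentBox b (suc i) t c
  plusFree⇒SegmentBox c noPlus t e with m≤n⇒m<n∨m≡n (≤-pred (rowBound t c (suc i) e))
  ... | inj₁ t<i  = s≤s t<i , e
  ... | inj₂ refl = ⊥-elim (noPlus h (diagonalAbove c e))

  diagonalLeft : ∀ c c' → c' ≤ c → entry b h c ≡ just i → entry b h c' ≡ just i
  diagonalLeft c c' c'≤c e with entry-left b h c'≤c e
  ... | y , ey = trans ey (cong just (≤-antisym (rowWeak h c' c y i c'≤c ey e) (rowBound h c' y ey)))

  plusFree⊎segmentFreeLeft : ∀ c → (∀ t → entry b t c ≢ just i) ⊎ (∀ c' → c' ≤ c → ∀ t → ¬ SegmentBox b (suc i) t c')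
  plusFree⊎segmentFreeLeft c with columnHas? b c i
  ... | inj₂ noPlus = inj₁ noPlus
  ... | inj₁ (t , e) with m≤n⇒m<n∨m≡n (≤-pred (rowBound t c i e))
  ... | inj₁ t+1<i = inj₂ λ c' c'≤c t' u → <⇒≱ (ordered t c t' c' (s≤s t+1<i , e) u) c'≤c
  ... | inj₂ refl  = inj₂ noSegment
    where
    noSegment : ∀ c' → c' ≤ c → ∀ t' → ¬ SegmentBox b (suc i) t' c'
    noSegment c' c'≤c t' (s≤s t'<i , e') with m≤n⇒m<n∨m≡n (≤-pred t'<i)
    ... | inj₂ refl   = 1+n≢n (just-injective (trans (sym e') (diagonalLeft c c' c'≤c e)))
    ... | inj₁ t'<h = 1+n≰n (≤-trans (colStrict t' h c' (suc i) i t'<h e' (diagonalLeft c c' c'≤c e)) (n≤1+n _))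

  scan-segmentFree : ∀ M p acc → (∀ c → c < M → ∀ t → ¬ SegmentBox b (suc i) t c) →
    proj₂ (scan i (columns b M) p acc) ≡ acc
  scan-segmentFree zero    p acc none = refl
  scan-segmentFree (suc M) p acc none
    rewrite scan-++ i (columnRead M 0 b) (columns b M) p acc =
      trans (scan-segmentFree M _ _ (λ c c<M → none c (m≤n⇒m≤1+n c<M)))
            (scan-cancellingColumn i M b 0 p acc (segmentFree⇒ColumnCancels M p (none M ≤-refl)))

  LeftmostSegmentBox : ℕ → ℕ → ℕ → Set
  LeftmostSegmentBox M t c =
    SegmentBox b (suc i) t c × c < M × ∀ t' c' → c' < M → SegmentBox b (suc i) t' c' → c ≤ c'

  ScanResult : ℕ → Maybe (ℕ × ℕ) → Maybe (ℕ × ℕ) → Set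
  ScanResult M acc R =
    (R ≡ acc × ∀ t c → c < M → ¬ SegmentBox b (suc i) t c)
    ⊎ ∃[ t ] ∃[ c ] R ≡ just (t , c) × LeftmostSegmentBox M t c

  scan-columns : ∀ M acc → ScanResult M acc (proj₂ (scan i (columns b M) 0 acc))
  scan-columns zero acc = inj₁ (refl , λ t c ())
  scan-columns (suc M) acc rewrite scan-++ i (columnRead M 0 b) (columns b M) 0 acc with plusFree⊎segmentFreeLeft M
  ... | inj₂ none = inj₁ (trans (scan-segmentFree M _ _ (λ c c<M → none c (<⇒≤ c<M)))
                               (scan-cancellingColumn i M b 0 0 acc (segmentFree⇒ColumnCancels M 0 (none M ≤-refl)))
                        , λ t c c≤M → none c (≤-pred c≤M) t)
  ... | inj₁ noPlus with scan-plusFreeColumn i M b 0 acc noPlus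
  ... | acc' , eq , column rewrite eq with scan-columns M acc' | column
  ... | inj₁ (e , none) | inj₁ (refl , noMinus) = inj₁ (e , none')
    where
    none' : ∀ t c → c < suc M → ¬ SegmentBox b (suc i) t c
    none' t c c≤M u with m≤n⇒m<n∨m≡n (≤-pred c≤M)
    ... | inj₁ c<M  = none t c c<M u
    ... | inj₂ refl = noMinus t (proj₂ u)
  ... | inj₁ (e , none) | inj₂ (t , refl , et) =
        inj₂ (t , M , e , plusFree⇒SegmentBox M noPlus t et , ≤-refl , leftmost)
    where
    leftmost : ∀ t' c' → c' < suc M → SegmentBox b (suc i) t' c' → M ≤ c'
    leftmost t' c' c'≤M u with m≤n⇒m<n∨m≡n (≤-pred c'≤M)
    ... | inj₁ c'<M = ⊥-elim (none t' c' c'<M u)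
    ... | inj₂ refl = ≤-refl
  ... | inj₂ (t , c , e , u , c<M , leftmost) | _ = inj₂ (t , c , e , u , m≤n⇒m≤1+n c<M , leftmost')
    where
    leftmost' : ∀ t' c' → c' < suc M → SegmentBox b (suc i) t' c' → c ≤ c'
    leftmost' t' c' c'≤M u' with m≤n⇒m<n∨m≡n (≤-pred c'≤M)
    ... | inj₁ c'<M = leftmost t' c' c'<M u'
    ... | inj₂ refl = <⇒≤ c<M

  signature : (rightmostMinus i (reading b) 0 nothing ≡ nothing × ∀ t c → ¬ SegmentBox b (suc i) t c)
            ⊎ ∃[ t ] ∃[ c ] rightmostMinus i (reading b) 0 nothing ≡ just (t , c) × SegmentBox b (suc i) t c
                             × ∀ t' c' → SegmentBox b (suc i) t' c' → c ≤ c'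
  signature rewrite rightmostMinus≡scan i (reading b) 0 nothing with scan-columns (maxLen b) nothing
  ... | inj₁ (e , none) = inj₁ (e , λ t c u → none t c (entry⇒<maxLen b t c (proj₂ u)) u)
  ... | inj₂ (t , c , e , u , _ , leftmost) =
        inj₂ (t , c , e , u , λ t' c' u' → leftmost t' c' (entry⇒<maxLen b t' c' (proj₂ u')) u')

-- Changing an entry and removing a column

setEntry : ℕ → ℕ → ℕ → Tableau → Tableau
setEntry t c v = modifyAt t (modifyAt c (λ _ → v))

length-modifyAt : ∀ c (f : ℕ → ℕ) row → length (modifyAt c f row) ≡ length row
length-modifyAt c       f []        = refl
length-modifyAt zero    f (x ∷ row) = refl
length-modifyAt (suc c) f (x ∷ row) = cong suc (length-modifyAt c f row)

nth-modifyAt-≡ : ∀ {A : Set} c (f : A → A) row → nth c (modifyAt c f row) ≡ Maybe.map f (nth c row)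
nth-modifyAt-≡ c       f []        = refl
nth-modifyAt-≡ zero    f (x ∷ row) = refl
nth-modifyAt-≡ (suc c) f (x ∷ row) = nth-modifyAt-≡ c f row

nth-modifyAt-≢ : ∀ {A : Set} c c' (f : A → A) row → c ≢ c' → nth c' (modifyAt c f row) ≡ nth c' row
nth-modifyAt-≢ c       c'       f []        _   = refl
nth-modifyAt-≢ zero    zero     f (x ∷ row) c≢c = ⊥-elim (c≢c refl)
nth-modifyAt-≢ zero    (suc c') f (x ∷ row) _   = refl
nth-modifyAt-≢ (suc c) zero     f (x ∷ row) _   = refl
nth-modifyAt-≢ (suc c) (suc c') f (x ∷ row) c≢c' = nth-modifyAt-≢ c c' f row (c≢c' ∘ cong suc)

entry-setEntry-≡ : ∀ b t c v → entry (setEntry t c v b) t c ≡ Maybe.map (λ _ → v) (entry b t c)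
entry-setEntry-≡ []        t       c v = refl
entry-setEntry-≡ (row ∷ b) zero    c v = nth-modifyAt-≡ c (λ _ → v) row
entry-setEntry-≡ (row ∷ b) (suc t) c v = entry-setEntry-≡ b t c v

entry-setEntry-≢ : ∀ b t c v j c' → t ≢ j ⊎ c ≢ c' → entry (setEntry t c v b) j c' ≡ entry b j c'
entry-setEntry-≢ []        t       c v j       c' _ = refl
entry-setEntry-≢ (row ∷ b) zero    c v zero    c' (inj₁ t≢j) = ⊥-elim (t≢j refl)
entry-setEntry-≢ (row ∷ b) zero    c v zero    c' (inj₂ c≢c') = nth-modifyAt-≢ c c' _ row c≢c'
entry-setEntry-≢ (row ∷ b) zero    c v (suc j) c' _ = refl
entry-setEntry-≢ (row ∷ b) (suc t) c v zero    c' _ = refl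
entry-setEntry-≢ (row ∷ b) (suc t) c v (suc j) c' (inj₁ t≢j) = entry-setEntry-≢ b t c v j c' (inj₁ (t≢j ∘ cong suc))
entry-setEntry-≢ (row ∷ b) (suc t) c v (suc j) c' (inj₂ c≢c') = entry-setEntry-≢ b t c v j c' (inj₂ c≢c')

entry-setEntry : ∀ b t c v j c' {x} → entry (setEntry t c v b) j c' ≡ just x →
  (j ≡ t × c' ≡ c × x ≡ v) ⊎ (entry b j c' ≡ just x × (t ≢ j ⊎ c ≢ c'))
entry-setEntry b t c v j c' e with t ≟ j | c ≟ c'
... | no t≢j   | _        = inj₂ (trans (sym (entry-setEntry-≢ b t c v j c' (inj₁ t≢j))) e , inj₁ t≢j)
... | yes _    | no c≢c'  = inj₂ (trans (sym (entry-setEntry-≢ b t c v j c' (inj₂ c≢c'))) e , inj₂ c≢c')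
... | yes refl | yes refl with entry b t c | entry-setEntry-≡ b t c v
...   | just _ | e' = inj₁ (refl , refl , sym (just-injective (trans (sym e') e)))
...   | nothing | e' = ⊥-elim (≡nothing⇒≢just e' e)

setEntry-Defined : ∀ b t c v j c' → Defined (entry b j c') → Defined (entry (setEntry t c v b) j c')
setEntry-Defined b t c v j c' (y , e) with t ≟ j | c ≟ c'
... | yes refl | yes refl = v , trans (entry-setEntry-≡ b t c v) (cong (Maybe.map _) e)
... | no t≢j   | _        = y , trans (entry-setEntry-≢ b t c v j c' (inj₁ t≢j)) e
... | yes _    | no c≢c'  = y , trans (entry-setEntry-≢ b t c v j c' (inj₂ c≢c')) e

nth-setEntry-≡ : ∀ b t c v {row} → nth t b ≡ just row → nth t (setEntry t c v b) ≡ just (modifyAt c (λ _ → v) row)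
nth-setEntry-≡ b t c v e rewrite nth-modifyAt-≡ t (modifyAt c (λ _ → v)) b | e = refl

rowLen-setEntry : ∀ b t c v j → rowLen j (setEntry t c v b) ≡ rowLen j b
rowLen-setEntry b t c v j with t ≟ j
... | no t≢j rewrite nth-modifyAt-≢ t j (modifyAt c (λ _ → v)) b t≢j = refl
... | yes refl rewrite nth-modifyAt-≡ t (modifyAt c (λ _ → v)) b with nth t b
...   | nothing  = refl
...   | just row = length-modifyAt c _ row

count-set : ∀ v c y row {x} → nth c row ≡ just x → x ≢ v → y ≢ v →
  count v (modifyAt c (λ _ → y) row) ≡ count v row
count-set v zero y (z ∷ row) refl z≢v y≢v rewrite ≢⇒≡ᵇ-false z≢v | ≢⇒≡ᵇ-false y≢v = refl
count-set v (suc c) y (z ∷ row) e x≢v y≢v with z ≡ᵇ v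
... | true  = cong suc (count-set v c y row e x≢v y≢v)
... | false = count-set v c y row e x≢v y≢v

count-set-≡ : ∀ v c row {x} → nth c row ≡ just x → x ≢ v → count v (modifyAt c (λ _ → v) row) ≡ suc (count v row)
count-set-≡ v zero (z ∷ row) refl z≢v rewrite ≢⇒≡ᵇ-false z≢v | ≡ᵇ-refl v = refl
count-set-≡ v (suc c) (z ∷ row) e x≢v with z ≡ᵇ v
... | true  = cong suc (count-set-≡ v c row e x≢v)
... | false = count-set-≡ v c row e x≢v

count≤ : ∀ v c row → (∀ c' → c ≤ c' → nth c' row ≢ just v) → count v row ≤ c
count≤ v c [] _ = z≤n
count≤ v zero (y ∷ row) none with y ≡ᵇ v | ≡ᵇ-reflects y v
... | true  | ofʸ refl = ⊥-elim (none 0 z≤n refl)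
... | false | _        = count≤ v zero row (λ c' _ → none (suc c') z≤n)
count≤ v (suc c) (y ∷ row) none with y ≡ᵇ v
... | true  = s≤s (count≤ v c row (λ c' c≤c' → none (suc c') (s≤s c≤c')))
... | false = m≤n⇒m≤1+n (count≤ v c row (λ c' c≤c' → none (suc c') (s≤s c≤c')))

-- After removing entry c of a row, its entry c' is entry (skip c c') of the original row.
skip : ℕ → ℕ → ℕ
skip zero    c'       = suc c'
skip (suc c) zero     = zero
skip (suc c) (suc c') = suc (skip c c')

skip-mono : ∀ c {c' c''} → c' ≤ c'' → skip c c' ≤ skip c c''
skip-mono zero    c'≤c''       = s≤s c'≤c''
skip-mono (suc c) {zero} _     = z≤n
skip-mono (suc c) (s≤s c'≤c'') = s≤s (skip-mono c c'≤c'')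

skip-cancel-< : ∀ c {c' c''} → skip c c' < skip c c'' → c' < c''
skip-cancel-< c {c'} {c''} lt with c' <? c''
... | yes c'<c'' = c'<c''
... | no  c'≮c'' = ⊥-elim (<⇒≱ lt (skip-mono c (≮⇒≥ c'≮c'')))

nth-removeAt : ∀ {A : Set} c c' (row : List A) → nth c' (removeAt c row) ≡ nth (skip c c') row
nth-removeAt c       c'       []        = refl
nth-removeAt zero    c'       (x ∷ row) = refl
nth-removeAt (suc c) zero     (x ∷ row) = refl
nth-removeAt (suc c) (suc c') (x ∷ row) = nth-removeAt c c' row

entry-removeCol : ∀ c b j c' → entry (removeCol c b) j c' ≡ entry b j (skip c c')
entry-removeCol c []        j       c' = refl
entry-removeCol c (row ∷ b) zero    c' = nth-removeAt c c' row
entry-removeCol c (row ∷ b) (suc j) c' = entry-removeCol c b j c'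

removeAt-modifyAt : ∀ {A : Set} c (f : A → A) row → removeAt c (modifyAt c f row) ≡ removeAt c row
removeAt-modifyAt c       f []        = refl
removeAt-modifyAt zero    f (x ∷ row) = refl
removeAt-modifyAt (suc c) f (x ∷ row) = cong (x ∷_) (removeAt-modifyAt c f row)

removeCol-setEntry : ∀ c t v b → removeCol c (setEntry t c v b) ≡ removeCol c b
removeCol-setEntry c t       v []        = refl
removeCol-setEntry c zero    v (row ∷ b) = cong (_∷ map (removeAt c) b) (removeAt-modifyAt c _ row)
removeCol-setEntry c (suc t) v (row ∷ b) = cong (removeAt c row ∷_) (removeCol-setEntry c t v b)

removeAt-nothing : ∀ {A : Set} c (row : List A) → nth c row ≡ nothing → removeAt c row ≡ row
removeAt-nothing c       []        _ = refl
removeAt-nothing zero    (x ∷ row) ()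
removeAt-nothing (suc c) (x ∷ row) e = cong (x ∷_) (removeAt-nothing c row e)

length-removeAt : ∀ c (row : List ℕ) {x} → nth c row ≡ just x → suc (length (removeAt c row)) ≡ length row
length-removeAt zero    (y ∷ row) _ = refl
length-removeAt (suc c) (y ∷ row) e = cong suc (length-removeAt c row e)

count-removeAt-≡ : ∀ v c row → nth c row ≡ just v → suc (count v (removeAt c row)) ≡ count v row
count-removeAt-≡ v zero (y ∷ row) refl rewrite ≡ᵇ-refl v = refl
count-removeAt-≡ v (suc c) (y ∷ row) e with y ≡ᵇ v
... | true  = cong suc (count-removeAt-≡ v c row e)
... | false = count-removeAt-≡ v c row e

count-removeAt-≢ : ∀ v c row {x} → nth c row ≡ just x → x ≢ v → count v (removeAt c row) ≡ count v row
count-removeAt-≢ v zero (y ∷ row) refl y≢v rewrite ≢⇒≡ᵇ-false y≢v = refl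
count-removeAt-≢ v (suc c) (y ∷ row) e x≢v with y ≡ᵇ v
... | true  = cong suc (count-removeAt-≢ v c row e x≢v)
... | false = count-removeAt-≢ v c row e x≢v

mlRows-true : ∀ j₀ b → (∀ j row → nth j b ≡ just row → count (suc (j₀ + j)) row ≡ suc (rowLen (suc j) b)) →
  mlRows j₀ b ≡ true
mlRows-true j₀ []        _ = refl
mlRows-true j₀ (row ∷ b) ml
  with count (suc j₀) row ≡ᵇ suc (rowLen 0 b) | ≡ᵇ-reflects (count (suc j₀) row) (suc (rowLen 0 b))
... | false | ofⁿ ≢ml = ⊥-elim (≢ml (trans (cong (λ z → count (suc z) row) (sym (+-identityʳ j₀))) (ml 0 row refl)))
... | true  | _ =
    mlRows-true (suc j₀) b (λ j row' e → trans (cong (λ z → count (suc z) row') (sym (+-suc j₀ j))) (ml (suc j) row' e))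

isML-true : ∀ b → MarginallyLarge b → isML b ≡ true
isML-true = mlRows-true 0

mlRows-false : ∀ j₀ b j row → nth j b ≡ just row → count (suc (j₀ + j)) row ≢ suc (rowLen (suc j) b) →
  mlRows j₀ b ≡ false
mlRows-false j₀ (row ∷ b) zero .row refl ≢ml
  rewrite ≢⇒≡ᵇ-false (≢ml ∘ trans (cong (λ z → count (suc z) row) (+-identityʳ j₀))) = refl
mlRows-false j₀ (row ∷ b) (suc j) row' e ≢ml with count (suc j₀) row ≡ᵇ suc (rowLen 0 b)
... | false = refl
... | true  = mlRows-false (suc j₀) b j row' e (≢ml ∘ trans (cong (λ z → count (suc z) row') (+-suc j₀ j)))

isML-false : ∀ b j row → nth j b ≡ just row → count (suc j) row ≢ suc (rowLen (suc j) b) → isML b ≡ false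
isML-false = mlRows-false 0

e~-nothing : ∀ i b → rightmostMinus i (reading b) 0 nothing ≡ nothing → e~ i b ≡ nothing
e~-nothing i b e with rightmostMinus i (reading b) 0 nothing
e~-nothing i b refl | .nothing = refl

e~-just : ∀ i b t c → rightmostMinus i (reading b) 0 nothing ≡ just (t , c) →
  e~ i b ≡ (if isML (setEntry t c i b) then just (setEntry t c i b) else just (removeCol c (setEntry t c i b)))
e~-just i b t c e with rightmostMinus i (reading b) 0 nothing
e~-just i b t c refl | .(just (t , c)) = refl

MarginallyLarge-setEntry : ∀ b t c v {x} → MarginallyLarge b → entry b t c ≡ just x → x ≢ suc t → v ≢ suc t →
  MarginallyLarge (setEntry t c v b)
MarginallyLarge-setEntry b t c v ml e x≢ v≢ j row e' with t ≟ j
... | no t≢j rewrite rowLen-setEntry b t c v (suc j) = ml j row (trans (sym (nth-modifyAt-≢ t j _ b t≢j)) e')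
... | yes refl with entry⇒nth b t c e
...   | row₀ , e₀ , ec rewrite rowLen-setEntry b t c v (suc t) | just-injective (trans (sym e') (nth-setEntry-≡ b t c v e₀)) =
        trans (count-set (suc t) c v row₀ ec x≢ v≢) (ml t row₀ e₀)

-- One application of ẽ_i

Lowering : ℕ → ℕ → Tableau → Set
Lowering k i b = ∀ j c x → entry b j c ≡ just x → suc j < k →
  x ≡ suc j ⊎ k < x ⊎ (suc j ≤ i × (x ≡ i ⊎ x ≡ suc i))

module LowerAboveRowI (k h : ℕ) (h+2≤k : suc (suc h) ≤ k) (b : Tableau) (w : WellFormed b)
                      (lowering : Lowering k (suc h) b) (ordered : SegmentsOrdered b (suc h))
                      (t c₀ : ℕ) (pick : rightmostMinus (suc h) (reading b) 0 nothing ≡ just (t , c₀))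
                      (t<h : t < h) (u : SegmentBox b (suc (suc h)) t c₀)
                      (leftmost : ∀ t' c' → SegmentBox b (suc (suc h)) t' c' → c₀ ≤ c') where
  open WellFormed w
  i = suc h
  b' = setEntry t c₀ i b

  eU : entry b t c₀ ≡ just (suc i)
  eU = proj₂ u

  above-t⇒<k : ∀ {j} → j ≤ t → suc j < k
  above-t⇒<k j≤t = ≤-trans (s≤s (s≤s (≤-trans j≤t (<⇒≤ t<h)))) h+2≤k

  leftOfBox : ∀ c x → c < c₀ → entry b t c ≡ just x → x ≤ i
  leftOfBox c x c<c₀ e with lowering t c x e (above-t⇒<k ≤-refl)
  ... | inj₁ refl                   = s≤s (<⇒≤ t<h)
  ... | inj₂ (inj₁ k<x)             = ⊥-elim (<⇒≱ k<x (≤-trans (rowWeak t c c₀ x (suc i) (<⇒≤ c<c₀) e eU) h+2≤k))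
  ... | inj₂ (inj₂ (_ , inj₁ refl)) = ≤-refl
  ... | inj₂ (inj₂ (_ , inj₂ refl)) = ⊥-elim (<⇒≱ c<c₀ (leftmost t c (proj₁ u , e)))

  -- An entry i above the box would be an i-segment box in column c₀.
  aboveBox : ∀ j x → j < t → entry b j c₀ ≡ just x → x < i
  aboveBox j x j<t e with colStrict j t c₀ x (suc i) j<t e eU | lowering j c₀ x e (above-t⇒<k (<⇒≤ j<t))
  ... | _   | inj₁ refl                   = s≤s (<-trans j<t t<h)
  ... | x<  | inj₂ (inj₁ k<x)             = ⊥-elim (<⇒≱ k<x (≤-trans (<⇒≤ x<) h+2≤k))
  ... | _   | inj₂ (inj₂ (_ , inj₁ refl)) = ⊥-elim (<-irrefl refl (ordered j c₀ t c₀ (s≤s (<-trans j<t t<h) , e) u))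
  ... | x<  | inj₂ (inj₂ (_ , inj₂ refl)) = ⊥-elim (<-irrefl refl x<)

  sameRow : ∀ {c} → t ≢ t ⊎ c₀ ≢ c → c ≢ c₀
  sameRow (inj₁ t≢t) _    = t≢t refl
  sameRow (inj₂ c₀≢c) c≡c₀ = c₀≢c (sym c≡c₀)

  wellFormed : WellFormed b'
  WellFormed.rowBound wellFormed j c x e with entry-setEntry b t c₀ i j c e
  ... | inj₁ (refl , refl , refl) = s≤s (<⇒≤ t<h)
  ... | inj₂ (e₀ , _)             = rowBound j c x e₀
  WellFormed.rowWeak wellFormed j c c' x y c≤c' ex ey with entry-setEntry b t c₀ i j c ex | entry-setEntry b t c₀ i j c' ey
  ... | inj₁ (refl , refl , refl) | inj₁ (_ , _ , refl) = ≤-refl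
  ... | inj₁ (refl , refl , refl) | inj₂ (ey₀ , _)      = ≤-trans (n≤1+n i) (rowWeak t c₀ c' (suc i) y c≤c' eU ey₀)
  ... | inj₂ (ex₀ , diff)          | inj₁ (refl , refl , refl) = leftOfBox c x (≤∧≢⇒< c≤c' (sameRow diff)) ex₀
  ... | inj₂ (ex₀ , _)            | inj₂ (ey₀ , _)      = rowWeak j c c' x y c≤c' ex₀ ey₀
  WellFormed.colStrict wellFormed j j' c x y j<j' ex ey with entry-setEntry b t c₀ i j c ex | entry-setEntry b t c₀ i j' c ey
  ... | inj₁ (refl , refl , refl) | inj₁ (refl , _ , _)       = ⊥-elim (<-irrefl refl j<j')
  ... | inj₁ (refl , refl , refl) | inj₂ (ey₀ , _)            = <-trans (n<1+n i) (colStrict t j' c₀ (suc i) y j<j' eU ey₀)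
  ... | inj₂ (ex₀ , _)            | inj₁ (refl , refl , refl) = aboveBox j x j<j' ex₀
  ... | inj₂ (ex₀ , _)            | inj₂ (ey₀ , _)            = colStrict j j' c x y j<j' ex₀ ey₀
  WellFormed.shape wellFormed j j' c y j≤j' e with entry-setEntry b t c₀ i j' c e
  ... | inj₁ (refl , refl , refl) = setEntry-Defined b t c₀ i j c₀ (shape j t c₀ (suc i) j≤j' eU)
  ... | inj₂ (e₀ , _)             = setEntry-Defined b t c₀ i j c (shape j j' c y j≤j' e₀)
  WellFormed.margLarge wellFormed =
    MarginallyLarge-setEntry b t c₀ i margLarge eU (λ e → <⇒≢ (<-trans t<h (n<1+n h)) (sym (suc-injective e)))
                                                   (λ e → <⇒≢ t<h (sym (suc-injective e)))

  lowering' : Lowering k i b'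
  lowering' j c x e j+1<k with entry-setEntry b t c₀ i j c e
  ... | inj₁ (refl , refl , refl) = inj₂ (inj₂ (<⇒≤ (s≤s t<h) , inj₁ refl))
  ... | inj₂ (e₀ , _)             = lowering j c x e₀ j+1<k

  ordered' : SegmentsOrdered b' i
  ordered' t₁ c₁ t₂ c₂ (t₁< , e₁) (t₂< , e₂) with entry-setEntry b t c₀ i t₂ c₂ e₂
  ... | inj₁ (_ , _ , i+1≡i) = ⊥-elim (1+n≢n i+1≡i)
  ... | inj₂ (e₂' , diff) with entry-setEntry b t c₀ i t₁ c₁ e₁
  ...   | inj₂ (e₁' , _)     = ordered t₁ c₁ t₂ c₂ (t₁< , e₁') (t₂< , e₂')
  ...   | inj₁ (refl , refl , _) = ≤∧≢⇒< (leftmost t₂ c₂ (t₂< , e₂')) (notBelow diff)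
    where
    -- Two entries i+1 cannot share a column.
    notBelow : t ≢ t₂ ⊎ c₀ ≢ c₂ → c₀ ≢ c₂
    notBelow (inj₂ c₀≢c₂) = c₀≢c₂
    notBelow (inj₁ t≢t₂) refl with <-cmp t t₂
    ... | tri< t<t₂ _ _ = <-irrefl refl (colStrict t t₂ c₀ (suc i) (suc i) t<t₂ eU e₂')
    ... | tri≈ _ t≡t₂ _ = t≢t₂ t≡t₂
    ... | tri> _ _ t₂<t = <-irrefl refl (colStrict t₂ t c₀ (suc i) (suc i) t₂<t e₂' eU)

  preserved : ∀ {b''} → e~ i b ≡ just b'' → WellFormed b'' × Lowering k i b'' × SegmentsOrdered b'' i
  preserved e~b rewrite e~-just i b t c₀ pick | isML-true b' (WellFormed.margLarge wellFormed) with e~b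
  ... | refl = wellFormed , lowering' , ordered'

rowLen-removeCol : ∀ c b j → rowLen j (removeCol c b) ≡ maybe (λ row → length (removeAt c row)) 0 (nth j b)
rowLen-removeCol c b j rewrite nth-map (removeAt c) j b with nth j b
... | nothing  = refl
... | just row = refl

-- The changed box directly follows the i's of row i, so the result is not marginally large and column c₀,
-- which holds 1,…,i above the box and nothing below it, is removed.
module LowerInRowI (k h : ℕ) (h+2≤k : suc (suc h) ≤ k) (b : Tableau) (w : WellFormed b)
                   (lowering : Lowering k (suc h) b) (ordered : SegmentsOrdered b (suc h))
                   (c₀ : ℕ) (pick : rightmostMinus (suc h) (reading b) 0 nothing ≡ just (h , c₀))
                   (u : SegmentBox b (suc (suc h)) h c₀) where
  open WellFormed w
  i = suc h
  b' = removeCol c₀ b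

  eU : entry b h c₀ ≡ just (suc i)
  eU = proj₂ u

  rowI : List ℕ
  rowI = proj₁ (entry⇒nth b h c₀ eU)

  nth-rowI : nth h b ≡ just rowI
  nth-rowI = proj₁ (proj₂ (entry⇒nth b h c₀ eU))

  rowI-c₀ : nth c₀ rowI ≡ just (suc i)
  rowI-c₀ = proj₂ (proj₂ (entry⇒nth b h c₀ eU))

  noIFrom : ∀ c → c₀ ≤ c → nth c rowI ≢ just i
  noIFrom c c₀≤c e = 1+n≰n (rowWeak h c₀ c (suc i) i c₀≤c eU (trans (entry-nth b h c nth-rowI) e))

  nextRowShort : suc (rowLen (suc h) b) ≤ c₀
  nextRowShort = subst (_≤ c₀) (margLarge h rowI nth-rowI) (count≤ i c₀ rowI noIFrom)

  nextRowEndsBefore : ∀ c → c₀ ≤ c → entry b (suc h) c ≡ nothing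
  nextRowEndsBefore c c₀≤c with entry b (suc h) c in e
  ... | nothing = refl
  ... | just y with entry⇒nth b (suc h) c e
  ...   | row , e-row , e-c = ⊥-elim (<⇒≱ (<-trans (nth⇒< row c e-c) (subst (λ z → suc z ≤ c₀) rowLen≡ nextRowShort)) c₀≤c)
    where
    rowLen≡ : rowLen (suc h) b ≡ length row
    rowLen≡ rewrite e-row = refl

  belowBoxEmpty : ∀ j → h < j → entry b j c₀ ≡ nothing
  belowBoxEmpty j h<j with entry b j c₀ in e
  ... | nothing = refl
  ... | just y with shape (suc h) j c₀ y h<j e
  ...   | z , ez = ⊥-elim (≡nothing⇒≢just (nextRowEndsBefore c₀ ≤-refl) ez)

  aboveBoxDiagonal : ∀ j → j < h → entry b j c₀ ≡ just (suc j)
  aboveBoxDiagonal j j<h with shape j h c₀ (suc i) (<⇒≤ j<h) eU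
  ... | y , ey with colStrict j h c₀ y (suc i) j<h ey eU | lowering j c₀ y ey (≤-trans (s≤s (s≤s (<⇒≤ j<h))) h+2≤k)
  ...   | _  | inj₁ refl                   = ey
  ...   | y< | inj₂ (inj₁ k<y)             = ⊥-elim (<⇒≱ k<y (≤-trans (<⇒≤ y<) h+2≤k))
  ...   | _  | inj₂ (inj₂ (_ , inj₁ refl)) = ⊥-elim (<-irrefl refl (ordered j c₀ h c₀ (s≤s j<h , ey) u))
  ...   | y< | inj₂ (inj₂ (_ , inj₂ refl)) = ⊥-elim (<-irrefl refl y<)

  setEntry-notML : isML (setEntry h c₀ i b) ≡ false
  setEntry-notML = isML-false (setEntry h c₀ i b) h (modifyAt c₀ (λ _ → i) rowI) (nth-setEntry-≡ b h c₀ i nth-rowI) tooMany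
    where
    tooMany : count i (modifyAt c₀ (λ _ → i) rowI) ≢ suc (rowLen (suc h) (setEntry h c₀ i b))
    tooMany e = 1+n≢n (begin
      suc (suc (rowLen (suc h) b))                    ≡⟨ cong suc (sym (margLarge h rowI nth-rowI)) ⟩
      suc (count i rowI)                              ≡⟨ sym (count-set-≡ i c₀ rowI rowI-c₀ 1+n≢n) ⟩
      count i (modifyAt c₀ (λ _ → i) rowI)            ≡⟨ e ⟩
      suc (rowLen (suc h) (setEntry h c₀ i b))        ≡⟨ cong suc (rowLen-setEntry b h c₀ i (suc h)) ⟩
      suc (rowLen (suc h) b)                          ∎)
      where open ≡-Reasoning

  entry-b' : ∀ j c → entry b' j c ≡ entry b j (skip c₀ c)
  entry-b' = entry-removeCol c₀ b

  rowLen-b'-unchanged : ∀ j → entry b j c₀ ≡ nothing → rowLen j b' ≡ rowLen j b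
  rowLen-b'-unchanged j e rewrite rowLen-removeCol c₀ b j with nth j b in e-row
  ... | nothing  = refl
  ... | just row = cong length (removeAt-nothing c₀ row (trans (sym (entry-nth b j c₀ e-row)) e))

  margLarge-aboveBox : ∀ {j row} → j < h → nth j b ≡ just row → count (suc j) (removeAt c₀ row) ≡ suc (rowLen (suc j) b')
  margLarge-aboveBox {j} {row} j<h e-row with shape (suc j) h c₀ (suc i) j<h eU
  ... | y , ey with entry⇒nth b (suc j) c₀ ey
  ...   | row₁ , e-row₁ , e-c rewrite rowLen-removeCol c₀ b (suc j) | e-row₁ = suc-injective (begin
    suc (count (suc j) (removeAt c₀ row))   ≡⟨ count-removeAt-≡ (suc j) c₀ row diagonal ⟩
    count (suc j) row                       ≡⟨ margLarge j row e-row ⟩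
    suc (rowLen (suc j) b)                  ≡⟨ cong (λ r → suc (maybe length 0 r)) e-row₁ ⟩
    suc (length row₁)                       ≡⟨ cong suc (sym (length-removeAt c₀ row₁ e-c)) ⟩
    suc (suc (length (removeAt c₀ row₁)))   ∎)
    where
    open ≡-Reasoning
    diagonal : nth c₀ row ≡ just (suc j)
    diagonal = trans (sym (entry-nth b j c₀ e-row)) (aboveBoxDiagonal j j<h)

  margLarge-rowI : ∀ {row} → nth h b ≡ just row → count i (removeAt c₀ row) ≡ suc (rowLen (suc h) b')
  margLarge-rowI {row} e-row = begin
    count i (removeAt c₀ row)   ≡⟨ count-removeAt-≢ i c₀ row (trans (sym (entry-nth b h c₀ e-row)) eU) 1+n≢n ⟩
    count i row                 ≡⟨ margLarge h row e-row ⟩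
    suc (rowLen (suc h) b)      ≡⟨ cong suc (sym (rowLen-b'-unchanged (suc h) (nextRowEndsBefore c₀ ≤-refl))) ⟩
    suc (rowLen (suc h) b')     ∎
    where open ≡-Reasoning

  margLarge-belowBox : ∀ {j row} → h < j → nth j b ≡ just row → count (suc j) (removeAt c₀ row) ≡ suc (rowLen (suc j) b')
  margLarge-belowBox {j} {row} h<j e-row
    rewrite removeAt-nothing c₀ row (trans (sym (entry-nth b j c₀ e-row)) (belowBoxEmpty j h<j)) = begin
    count (suc j) row           ≡⟨ margLarge j row e-row ⟩
    suc (rowLen (suc j) b)      ≡⟨ cong suc (sym (rowLen-b'-unchanged (suc j) (belowBoxEmpty (suc j) (<-trans h<j (n<1+n j))))) ⟩
    suc (rowLen (suc j) b')     ∎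
    where open ≡-Reasoning

  margLarge' : MarginallyLarge b'
  margLarge' j row e with nth j b in e-row | trans (sym (nth-map (removeAt c₀) j b)) e
  ... | just row₀ | refl with <-cmp j h
  ...   | tri< j<h _ _  = margLarge-aboveBox j<h e-row
  ...   | tri≈ _ refl _ = margLarge-rowI e-row
  ...   | tri> _ _ h<j  = margLarge-belowBox h<j e-row

  fromB' : ∀ {j c x} → entry b' j c ≡ just x → entry b j (skip c₀ c) ≡ just x
  fromB' {j} {c} = trans (sym (entry-b' j c))

  wellFormed : WellFormed b'
  WellFormed.rowBound wellFormed j c x e = rowBound j (skip c₀ c) x (fromB' e)
  WellFormed.rowWeak wellFormed j c c' x y c≤c' ex ey =
    rowWeak j (skip c₀ c) (skip c₀ c') x y (skip-mono c₀ c≤c') (fromB' ex) (fromB' ey)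
  WellFormed.colStrict wellFormed j j' c x y j<j' ex ey = colStrict j j' (skip c₀ c) x y j<j' (fromB' ex) (fromB' ey)
  WellFormed.shape wellFormed j j' c y j≤j' e with shape j j' (skip c₀ c) y j≤j' (fromB' e)
  ... | z , ez = z , trans (entry-b' j c) ez
  WellFormed.margLarge wellFormed = margLarge'

  lowering' : Lowering k i b'
  lowering' j c x e = lowering j (skip c₀ c) x (fromB' e)

  ordered' : SegmentsOrdered b' i
  ordered' t₁ c₁ t₂ c₂ (t₁< , e₁) (t₂< , e₂) =
    skip-cancel-< c₀ (ordered t₁ (skip c₀ c₁) t₂ (skip c₀ c₂) (t₁< , fromB' e₁) (t₂< , fromB' e₂))

  preserved : ∀ {b''} → e~ i b ≡ just b'' → WellFormed b'' × Lowering k i b'' × SegmentsOrdered b'' i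
  preserved e~b rewrite e~-just i b h c₀ pick | setEntry-notML | removeCol-setEntry c₀ h i b with e~b
  ... | refl = wellFormed , lowering' , ordered'

e~-preserves : ∀ k h {b b'} → suc (suc h) ≤ k → WellFormed b → Lowering k (suc h) b → SegmentsOrdered b (suc h) →
  e~ (suc h) b ≡ just b' → WellFormed b' × Lowering k (suc h) b' × SegmentsOrdered b' (suc h)
e~-preserves k h {b} h+2≤k w lowering ordered e~b with Signature.signature b w h ordered
... | inj₁ (none , _) = ⊥-elim (≡nothing⇒≢just (e~-nothing (suc h) b none) e~b)
... | inj₂ (t , c , pick , u , leftmost) with m≤n⇒m<n∨m≡n (≤-pred (≤-pred (proj₁ u)))
...   | inj₁ t<h  = LowerAboveRowI.preserved k h h+2≤k b w lowering ordered t c pick t<h u leftmost e~b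
...   | inj₂ refl = LowerInRowI.preserved k h h+2≤k b w lowering ordered c pick u e~b

-- Applying ẽ_i maximally

ReadyFor : ℕ → ℕ → Tableau → Set
ReadyFor k i b = ∀ j c x → entry b j c ≡ just x → suc j < k →
  x ≡ suc j ⊎ k < x ⊎ (suc j ≤ i × x ≡ suc i)

ReadyFor⇒Lowering : ∀ {k i b} → ReadyFor k i b → Lowering k i b
ReadyFor⇒Lowering ready j c x e j+1<k with ready j c x e j+1<k
... | inj₁ diagonal           = inj₁ diagonal
... | inj₂ (inj₁ k<x)         = inj₂ (inj₁ k<x)
... | inj₂ (inj₂ (j<i , x≡)) = inj₂ (inj₂ (j<i , inj₂ x≡))

ReadyFor⇒SegmentsOrdered : ∀ {k i b} → i < k → ReadyFor k i b → SegmentsOrdered b i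
ReadyFor⇒SegmentsOrdered {k} {i} i<k ready t c _ _ (t+1<i , e) _ with ready t c i e (<-trans t+1<i i<k)
... | inj₁ refl              = ⊥-elim (<-irrefl refl t+1<i)
... | inj₂ (inj₁ k<i)         = ⊥-elim (<-asym k<i i<k)
... | inj₂ (inj₂ (_ , i≡i+1)) = ⊥-elim (1+n≢n (sym i≡i+1))

Lowering⇒ReadyFor : ∀ {k h b} → Lowering k (suc h) b → (∀ t c → ¬ SegmentBox b (suc (suc h)) t c) → ReadyFor k h b
Lowering⇒ReadyFor lowering none j c x e j+1<k with lowering j c x e j+1<k
... | inj₁ diagonal                    = inj₁ diagonal
... | inj₂ (inj₁ k<x)                  = inj₂ (inj₁ k<x)
... | inj₂ (inj₂ (j<i , inj₂ refl))    = ⊥-elim (none j c (s≤s j<i , e))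
... | inj₂ (inj₂ (j+1≤i , inj₁ refl)) with m≤n⇒m<n∨m≡n j+1≤i
...   | inj₁ (s≤s j+1≤h) = inj₂ (inj₂ (j+1≤h , refl))
...   | inj₂ j+1≡i       = inj₁ (sym j+1≡i)

e~pow-suc : ∀ i p b → e~pow i (suc p) b ≡ (e~pow i p b >>= e~ i)
e~pow-suc i zero b with e~ i b
... | nothing = refl
... | just _  = refl
e~pow-suc i (suc p) b with e~ i b
... | nothing = refl
... | just b' = e~pow-suc i p b'

e~pow-preserves : ∀ k h p {b b'} → suc (suc h) ≤ k → WellFormed b → Lowering k (suc h) b → SegmentsOrdered b (suc h) →
  e~pow (suc h) p b ≡ just b' → WellFormed b' × Lowering k (suc h) b' × SegmentsOrdered b' (suc h)
e~pow-preserves k h zero    h+2≤k w lowering ordered refl = w , lowering , ordered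
e~pow-preserves k h (suc p) {b} h+2≤k w lowering ordered e with e~ (suc h) b in e~b
... | just b₁ with e~-preserves k h h+2≤k w lowering ordered e~b
...   | w₁ , lowering₁ , ordered₁ = e~pow-preserves k h p h+2≤k w₁ lowering₁ ordered₁ e

e~-nothing⇒segmentFree : ∀ h {b} → WellFormed b → SegmentsOrdered b (suc h) → e~ (suc h) b ≡ nothing →
  ∀ t c → ¬ SegmentBox b (suc (suc h)) t c
e~-nothing⇒segmentFree h {b} w ordered e~b with Signature.signature b w h ordered
... | inj₁ (_ , none) = none
... | inj₂ (t , c , pick , _) = ⊥-elim (just≢nothing (trans (sym (e~-just (suc h) b t c pick)) e~b))
  where
  just≢nothing : ∀ {A : Set} {m : Bool} {x y : A} → (if m then just x else just y) ≢ nothing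
  just≢nothing {m = true}  ()
  just≢nothing {m = false} ()

lowerMaximally : ∀ k h p {b b'} → suc (suc h) ≤ k → WellFormed b → ReadyFor k (suc h) b →
  e~pow (suc h) p b ≡ just b' → e~pow (suc h) (suc p) b ≡ nothing → WellFormed b' × ReadyFor k h b'
lowerMaximally k h p {b} {b'} h+2≤k w ready e e-max with
  e~pow-preserves k h p h+2≤k w (ReadyFor⇒Lowering {b = b} ready) (ReadyFor⇒SegmentsOrdered {b = b} h+2≤k ready) e
... | w' , lowering' , ordered' = w' , Lowering⇒ReadyFor {b = b'} lowering' (e~-nothing⇒segmentFree h w' ordered' stuck)
  where
  stuck : e~ (suc h) b' ≡ nothing
  stuck = begin
    e~ (suc h) b'                        ≡⟨ cong (_>>= e~ (suc h)) (sym e) ⟩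
    (e~pow (suc h) p b >>= e~ (suc h))   ≡⟨ sym (e~pow-suc (suc h) p b) ⟩
    e~pow (suc h) (suc p) b              ≡⟨ e-max ⟩
    nothing                              ∎
    where open ≡-Reasoning

-- The phases of the string parametrization

ReadyFor-nextPhase : ∀ m {b} → WellFormed b → ReadyFor (suc m) 0 b → ReadyFor (suc (suc m)) (suc m) b
ReadyFor-nextPhase m w ready j c x e (s≤s j+1≤m+1) with m≤n⇒m<n∨m≡n j+1≤m+1
... | inj₁ j+1<m+1 with ready j c x e j+1<m+1
...   | inj₁ diagonal      = inj₁ diagonal
...   | inj₂ (inj₂ (() , _))
...   | inj₂ (inj₁ m+1<x) with m≤n⇒m<n∨m≡n m+1<x
...     | inj₁ m+2<x = inj₂ (inj₁ m+2<x)
...     | inj₂ refl  = inj₂ (inj₂ (j+1≤m+1 , refl))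
ReadyFor-nextPhase m w ready j c x e (s≤s j+1≤m+1) | inj₂ refl with m≤n⇒m<n∨m≡n (WellFormed.rowBound w j c x e)
... | inj₂ j+1≡x = inj₁ (sym j+1≡x)
... | inj₁ j+1<x with m≤n⇒m<n∨m≡n j+1<x
...   | inj₁ m+2<x = inj₂ (inj₁ m+2<x)
...   | inj₂ refl  = inj₂ (inj₂ (j+1≤m+1 , refl))

ReadyFor⇒NoSegments : ∀ k b → ReadyFor k 0 b → NoSegmentsUpTo k b
ReadyFor⇒NoSegments k b ready (suc (suc j)) _ j+2≤k (suc m , row , _ , m+1≤j+1 , e-row , j+2∈row) with ∈⇒nth row j+2∈row
... | c , e with ready m c (suc (suc j)) (trans (entry-nth b m c e-row) e) (≤-trans (s≤s m+1≤j+1) j+2≤k)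
...   | inj₁ j+2≡m+1       = 1+n≰n (subst (λ z → suc z ≤ suc j) (suc-injective (sym j+2≡m+1)) m+1≤j+1)
...   | inj₂ (inj₁ k<j+2)   = <⇒≱ k<j+2 j+2≤k
...   | inj₂ (inj₂ (() , _))

-- The steps of phase m+1, whose operators are ẽ_{m+1}, …, ẽ_1.
phaseSteps : ℕ → List (ℕ × ℕ)
phaseSteps m = map (λ ℓ → (suc m , suc ℓ)) (upTo (suc m))

phaseSteps≡applyUpTo : ∀ m → phaseSteps m ≡ applyUpTo (λ ℓ → (suc m , suc ℓ)) (suc m)
phaseSteps≡applyUpTo m = map-upTo (λ ℓ → (suc m , suc ℓ)) (suc m)

steps-suc : ∀ m → steps (suc m) ≡ steps m ++ phaseSteps m
steps-suc m = begin
  concatMap phaseSteps (upTo (suc m))               ≡⟨ cong (concatMap phaseSteps) (sym (applyUpTo-∷ʳ (λ j → j) m)) ⟩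
  concatMap phaseSteps (upTo m ++ [ m ])            ≡⟨ concatMap-++ phaseSteps (upTo m) [ m ] ⟩
  steps m ++ (phaseSteps m ++ [])                   ≡⟨ cong (steps m ++_) (++-identityʳ (phaseSteps m)) ⟩
  steps m ++ phaseSteps m                           ∎
  where open ≡-Reasoning

steps-prefix : ∀ {m n} → m ≤′ n → ∃[ ys ] steps n ≡ steps m ++ ys
steps-prefix {m} ≤′-refl = [] , sym (++-identityʳ (steps m))
steps-prefix {m} (≤′-step {n} m≤′n) with steps-prefix m≤′n
... | ys , eq = ys ++ phaseSteps n , (begin
  steps (suc n)                    ≡⟨ steps-suc n ⟩
  steps n ++ phaseSteps n          ≡⟨ cong (_++ phaseSteps n) eq ⟩
  (steps m ++ ys) ++ phaseSteps n  ≡⟨ ++-assoc (steps m) ys (phaseSteps n) ⟩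
  steps m ++ ys ++ phaseSteps n    ∎)
  where open ≡-Reasoning

steps-suc-++ : ∀ m rest → steps (suc m) ++ rest ≡ steps m ++ phaseSteps m ++ rest
steps-suc-++ m rest = trans (cong (_++ rest) (steps-suc m)) (++-assoc (steps m) (phaseSteps m) rest)

module _ (a : ℕ → ℕ → ℕ) where

  applySteps-++ : ∀ xs ys b → applySteps a (xs ++ ys) b ≡ (applySteps a xs b >>= applySteps a ys)
  applySteps-++ []             ys b = refl
  applySteps-++ ((j , ℓ) ∷ xs) ys b with e~pow (opIndex (j , ℓ)) (a j ℓ) b
  ... | nothing = refl
  ... | just b' = applySteps-++ xs ys b'

  lowerAll : ∀ k n (f : ℕ → ℕ × ℕ) b rest → (∀ ℓ → opIndex (f ℓ) ≡ n ∸ ℓ) → n < k → WellFormed b →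
    ReadyFor k n b → IsString a (applyUpTo f n ++ rest) b →
    ∃[ b' ] applySteps a (applyUpTo f n) b ≡ just b' × IsString a rest b' × WellFormed b' × ReadyFor k 0 b'
  lowerAll k zero    f b rest _ _ w ready is = b , refl , is , w , ready
  lowerAll k (suc n) f b rest op n<k w ready (b₁ , e , e-max , is)
    with lowerMaximally k n p n<k w ready (subst (λ i → e~pow i p b ≡ just b₁) (op 0) e)
                                          (subst (λ i → e~pow i (suc p) b ≡ nothing) (op 0) e-max)
    where p = a (proj₁ (f 0)) (proj₂ (f 0))
  ... | w₁ , ready₁ rewrite e =
    lowerAll k n (λ ℓ → f (suc ℓ)) b₁ rest (λ ℓ → op (suc ℓ)) (<-trans (n<1+n n) n<k) w₁ ready₁ is

  phase : ∀ m b rest → WellFormed b → ReadyFor (suc m) 0 b → IsString a (phaseSteps m ++ rest) b →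
    ∃[ b' ] applySteps a (phaseSteps m) b ≡ just b' × IsString a rest b' × WellFormed b' × ReadyFor (suc (suc m)) 0 b'
  phase m b rest w ready is
    with lowerAll (suc (suc m)) (suc m) (λ ℓ → (suc m , suc ℓ)) b rest (λ _ → refl) ≤-refl w (ReadyFor-nextPhase m w ready)
                  (subst (λ xs → IsString a (xs ++ rest) b) (phaseSteps≡applyUpTo m) is)
  ... | b' , e , result = b' , trans (cong (λ xs → applySteps a xs b) (phaseSteps≡applyUpTo m)) e , result

  phases : ∀ m b rest → WellFormed b → IsString a (steps m ++ rest) b →
    ∃[ b' ] applySteps a (steps m) b ≡ just b' × IsString a rest b' × WellFormed b' × ReadyFor (suc m) 0 b'
  phases zero    b rest w is = b , refl , is , w , λ { _ _ _ _ (s≤s ()) }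
  phases (suc m) b rest w is
    with phases m b (phaseSteps m ++ rest) w (subst (λ xs → IsString a xs b) (steps-suc-++ m rest) is)
  ... | b₁ , e₁ , is₁ , w₁ , ready₁ with phase m b₁ rest w₁ ready₁ is₁
  ... | b₂ , e₂ , result = b₂ , applied , result
    where
    open ≡-Reasoning
    applied : applySteps a (steps (suc m)) b ≡ just b₂
    applied = begin
      applySteps a (steps (suc m)) b                            ≡⟨ cong (λ xs → applySteps a xs b) (steps-suc m) ⟩
      applySteps a (steps m ++ phaseSteps m) b                  ≡⟨ applySteps-++ (steps m) (phaseSteps m) b ⟩
      (applySteps a (steps m) b >>= applySteps a (phaseSteps m)) ≡⟨ cong (_>>= applySteps a (phaseSteps m)) e₁ ⟩
      applySteps a (phaseSteps m) b₁                            ≡⟨ e₂ ⟩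
      just b₂                                                   ∎

lemma3p5 : (r : ℕ) → 1 ≤ r → (b : Tableau) → IsTInf r b →
    (a : ℕ → ℕ → ℕ) → IsStringParam r b a →
    (k : ℕ) → 2 ≤ k → k ≤ suc r →
    Σ Tableau (λ b' → applySteps a (steps (k ∸ 1)) b ≡ just b' × NoSegmentsUpTo k b')
lemma3p5 r _ b T a ψ (suc m) _ (s≤s m≤r) with steps-prefix (≤⇒≤′ m≤r)
... | rest , steps-r with phases a m b rest (FromTInf.wellFormed T) (subst (λ xs → IsString a xs b) steps-r ψ)
... | b' , applied , _ , _ , ready = b' , applied , ReadyFor⇒NoSegments (suc m) b' ready
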